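{- For every integer $k\ge4$, the graph $G_k$ contains no even hole (no induced cycle of even length at least $4$).
   Context: For $k\ge4$, let $B_k$ be the graph obtained from a triangle by attaching a path of length $k$ at one of its vertices. The graph $G_k$ is built as follows: take disjoint copies $F_1,\dots,F_k$ of $B_k$; in $F_i$ let $a_i,b_i,c_i$ be the triangle vertices with $a_i$ the vertex of degree $3$, and let $r_i$ be the unique vertex of degree $1$ (the other end of the attached path). For each $i\in\{2,\dots,k\}$, add a new path $P_i$ of length $k$ between $r_i$ and $r_{i-1}$, and a new path $Q_i$ of length $k+1$ between $c_i$ and $b_{i-1}$ (the internal vertices of these paths are new and distinct). There are no other vertices or edges. -}

module Defs where

open import Data.Nat using (ℕ; zero; suc; _≤_; _<_; _∸_)
open import Data.Nat.Divisibility using (_∣_)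
open import Data.Fin using (Fin; toℕ)
open import Data.Product using (Σ; _×_; proj₁; ∃)
open import Data.Sum using (_⊎_)
open import Function.Bundles using (_⇔_)
open import Function.Definitions using (Injective)
open import Relation.Binary.PropositionalEquality using (_≡_)

record Graph : Set₁ where
  field
    V   : Set
    Adj : V → V → Set

CycAdj : (n : ℕ) → Fin n → Fin n → Set
CycAdj n i j =
    (suc (toℕ i) ≡ toℕ j)
  ⊎ (suc (toℕ j) ≡ toℕ i)
  ⊎ ((toℕ i ≡ 0) × (suc (toℕ j) ≡ n))
  ⊎ ((toℕ j ≡ 0) × (suc (toℕ i) ≡ n))

IsInducedCycle : (G : Graph) (n : ℕ) → (Fin n → Graph.V G) → Set
IsInducedCycle G n f =
  Injective _≡_ _≡_ f × (∀ i j → Graph.Adj G (f i) (f j) ⇔ CycAdj n i j)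

HasEvenHole : Graph → Set
HasEvenHole G =
  Σ ℕ λ n → (4 ≤ n) × (2 ∣ n) × (Σ (Fin n → Graph.V G) λ f → IsInducedCycle G n f)

-- Copies F_0,…,F_{k-1} (0-based).
--   a i, b i, c i : triangle of F_i (a i has degree 3 in F_i)
--   t i j (1 ≤ j ≤ k) : j-th vertex of the path of length k attached at
--                       a i (a i is position 0); r_i = t i k
--   p i j (1 ≤ i ≤ k-1, 1 ≤ j ≤ k-1) : internal vertices of the path P
--                       of length k from r_i (position 0) to r_{i-1} (position k)
--   q i j (1 ≤ i ≤ k-1, 1 ≤ j ≤ k) : internal vertices of the path Q
--                       of length k+1 from c_i (position 0) to b_{i-1} (position k+1)

data Vtx : Set where
  a b c : ℕ → Vtx
  t p q : ℕ → ℕ → Vtx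

data Valid (k : ℕ) : Vtx → Set where
  va : ∀ {i} → i < k → Valid k (a i)
  vb : ∀ {i} → i < k → Valid k (b i)
  vc : ∀ {i} → i < k → Valid k (c i)
  vt : ∀ {i j} → i < k → 1 ≤ j → j ≤ k → Valid k (t i j)
  vp : ∀ {i j} → 1 ≤ i → i < k → 1 ≤ j → j ≤ k ∸ 1 → Valid k (p i j)
  vq : ∀ {i j} → 1 ≤ i → i < k → 1 ≤ j → j ≤ k → Valid k (q i j)

data Edge (k : ℕ) : Vtx → Vtx → Set where
  e-ab : ∀ i → Edge k (a i) (b i)
  e-bc : ∀ i → Edge k (b i) (c i)
  e-ca : ∀ i → Edge k (c i) (a i)
  e-at : ∀ i → Edge k (a i) (t i 1)
  e-tt : ∀ i j → Edge k (t i j) (t i (suc j))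
  e-tp : ∀ i → Edge k (t i k) (p i 1)
  e-pp : ∀ i j → Edge k (p i j) (p i (suc j))
  e-pt : ∀ i j → suc j ≡ k → Edge k (p (suc i) j) (t i k)
  e-cq : ∀ i → Edge k (c i) (q i 1)
  e-qq : ∀ i j → Edge k (q i j) (q i (suc j))
  e-qb : ∀ i → Edge k (q (suc i) k) (b i)

G : ℕ → Graph
G k = record
  { V   = Σ Vtx (Valid k)
  ; Adj = λ u v → Edge k (proj₁ u) (proj₁ v) ⊎ Edge k (proj₁ v) (proj₁ u)
  }

-- Unroll an even hole of length n to a walk W : ℤ → V of period n.  Since n is even, vertices
-- at odd distance along W are distinct and vertices at even distance are non-adjacent.  Give
-- the vertices of G_k heights so that copy F_i, with the paths P_i and Q_i arriving at it,
-- lies above copy F_{i-1}.  A highest vertex of the hole can only be some a_i with hole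
-- neighbours t_{i,1} and c_i; from there the hole is forced along the rung and P_i on one side
-- and through Q_i on the other, arriving at r_{i-1} and b_{i-1}.  In each copy F_j the end at
-- r_j cannot go down the rung (a_j b_j would be a chord between vertices at even distance),
-- so it crosses P_j, and the end at b_j cannot go through a_j (it would meet r_j again at odd
-- distance), so it passes c_j into Q_j.  The parity of the distance between the two ends is
-- preserved, and the descent gets stuck at F_0, which has no P_0 or Q_0.

module Submission where

open import Defs
open import Data.Nat as ℕ using (ℕ; zero; suc; pred; z≤n; s≤s; _≤_; _<_; _≤?_; _∸_)
open import Data.Nat.Properties as ℕ using (≤-irrelevant)
open import Data.Nat.Divisibility as ℕ using ()
open import Data.Integer using (ℤ; ∣_∣; +_; 0ℤ; 1ℤ; _+_; _-_; -_; _*_; _%ℕ_; _/ℕ_)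
open import Data.Integer.Properties using (+-identityʳ; m-n≡m⊖n; ⊖-≥)
open import Data.Integer.DivMod using (n%ℕd<d; a≡a%ℕn+[a/ℕn]*n)
open import Data.Nat.DivMod using (m<n⇒m%n≡m)
open import Data.Fin using (Fin; toℕ; fromℕ<)
open import Data.Fin.Properties using (toℕ-fromℕ<; toℕ-injective; toℕ<n)
open import Data.List using (allFin)
open import Data.List.Extrema.Nat using (argmax; f[xs]≤f[argmax])
open import Data.List.Relation.Unary.All using (lookup)
open import Data.List.Membership.Propositional.Properties using (∈-allFin)
open import Function.Bundles using (_⇔_; Equivalence)
open import Function.Definitions using (Injective)
open import Data.Integer.Divisibility.Signed
  using (_∣_; divides; ∣⇒∣ᵤ; ∣ᵤ⇒∣; ∣-trans; ∣-refl; ∣m+n∣n⇒∣m; ∣m⇒∣-m; ∣m∣n⇒∣m+n; ∣m∣n⇒∣m-n)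
open import Data.Integer.Tactic.RingSolver using (solve-∀)
open import Data.Product using (Σ; _×_; _,_; proj₁; proj₂)
open import Data.Bool using (if_then_else_)
open import Data.Sum using (_⊎_; inj₁; inj₂; swap; map₂)
open import Data.Empty using (⊥; ⊥-elim)
open import Relation.Nullary using (¬_; does)
open import Relation.Nullary.Decidable using (dec-true; dec-false)
open import Relation.Binary.PropositionalEquality
  using (_≡_; _≢_; refl; sym; trans; cong; cong₂; subst; module ≡-Reasoning)

-- Graph.Adj (G k) u v is definitionally Adjacent k (proj₁ u) (proj₁ v).
Adjacent : ℕ → Vtx → Vtx → Set
Adjacent k u v = Edge k u v ⊎ Edge k v u

Valid-irrelevant : ∀ {k v} (x y : Valid k v) → x ≡ y
Valid-irrelevant (va x) (va y) rewrite ≤-irrelevant x y = refl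
Valid-irrelevant (vb x) (vb y) rewrite ≤-irrelevant x y = refl
Valid-irrelevant (vc x) (vc y) rewrite ≤-irrelevant x y = refl
Valid-irrelevant (vt x₁ x₂ x₃) (vt y₁ y₂ y₃)
  rewrite ≤-irrelevant x₁ y₁ | ≤-irrelevant x₂ y₂ | ≤-irrelevant x₃ y₃ = refl
Valid-irrelevant (vp x₁ x₂ x₃ x₄) (vp y₁ y₂ y₃ y₄)
  rewrite ≤-irrelevant x₁ y₁ | ≤-irrelevant x₂ y₂ | ≤-irrelevant x₃ y₃ | ≤-irrelevant x₄ y₄ = refl
Valid-irrelevant (vq x₁ x₂ x₃ x₄) (vq y₁ y₂ y₃ y₄)
  rewrite ≤-irrelevant x₁ y₁ | ≤-irrelevant x₂ y₂ | ≤-irrelevant x₃ y₃ | ≤-irrelevant x₄ y₄ = refl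

neighbours-a : ∀ {k i w} → Adjacent k (a i) w → w ≡ b i ⊎ w ≡ c i ⊎ w ≡ t i 1
neighbours-a (inj₁ (e-ab _)) = inj₁ refl
neighbours-a (inj₁ (e-at _)) = inj₂ (inj₂ refl)
neighbours-a (inj₂ (e-ca _)) = inj₂ (inj₁ refl)

neighbours-b : ∀ {k i w} → Adjacent k (b i) w → w ≡ a i ⊎ w ≡ c i ⊎ w ≡ q (suc i) k
neighbours-b (inj₁ (e-bc _)) = inj₂ (inj₁ refl)
neighbours-b (inj₂ (e-ab _)) = inj₁ refl
neighbours-b (inj₂ (e-qb _)) = inj₂ (inj₂ refl)

neighbours-c : ∀ {k i w} → Adjacent k (c i) w → w ≡ a i ⊎ w ≡ b i ⊎ w ≡ q i 1
neighbours-c (inj₁ (e-ca _)) = inj₁ refl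
neighbours-c (inj₁ (e-cq _)) = inj₂ (inj₂ refl)
neighbours-c (inj₂ (e-bc _)) = inj₂ (inj₁ refl)

neighbours-r : ∀ {k i w} → 2 ≤ k → Valid k w → Adjacent k (t i k) w →
               w ≡ t i (pred k) ⊎ w ≡ p i 1 ⊎ w ≡ p (suc i) (pred k)
neighbours-r _ (vt _ _ k<k) (inj₁ (e-tt _ _)) = ⊥-elim (ℕ.<-irrefl refl k<k)
neighbours-r _ _ (inj₁ (e-tp _)) = inj₂ (inj₁ refl)
neighbours-r (s≤s ()) _ (inj₂ (e-at _))
neighbours-r _ _ (inj₂ (e-tt _ _)) = inj₁ refl
neighbours-r _ _ (inj₂ (e-pt _ _ refl)) = inj₂ (inj₂ refl)

-- The l-th vertex of the rung a_i … r_i, of P_j from r_j to r_{j-1}, and of Q_j from c_j to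
-- b_{j-1}; along P_j and Q_j every position past the far end gives that end.
rung : ℕ → ℕ → Vtx
rung i zero    = a i
rung i (suc l) = t i (suc l)

pathP : ℕ → ℕ → ℕ → Vtx
pathP k j zero    = t j k
pathP k j (suc l) = if does (k ≤? suc l) then t (pred j) k else p j (suc l)

pathQ : ℕ → ℕ → ℕ → Vtx
pathQ k j zero    = c j
pathQ k j (suc l) = if does (k ≤? l) then b (pred j) else q j (suc l)

pathP-interior : ∀ {k j l} → suc l < k → pathP k j (suc l) ≡ p j (suc l)
pathP-interior {k} {l = l} l<k rewrite dec-false (k ≤? suc l) (ℕ.<⇒≱ l<k) = refl

pathP-end : ∀ {k j} → 1 ≤ k → pathP k j k ≡ t (pred j) k
pathP-end {suc k} _ rewrite dec-true (suc k ≤? suc k) ℕ.≤-refl = refl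

pathQ-interior : ∀ {k j l} → l < k → pathQ k j (suc l) ≡ q j (suc l)
pathQ-interior {k} {l = l} l<k rewrite dec-false (k ≤? l) (ℕ.<⇒≱ l<k) = refl

pathQ-end : ∀ {k j} → pathQ k j (suc k) ≡ b (pred j)
pathQ-end {k} rewrite dec-true (k ≤? k) ℕ.≤-refl = refl

DegreeTwoInterior : ℕ → (ℕ → Vtx) → ℕ → Set
DegreeTwoInterior k π N =
  ∀ {l w} → suc l < N → Valid k w → Adjacent k (π (suc l)) w → w ≡ π l ⊎ w ≡ π (suc (suc l))

rung-degreeTwo : ∀ {k} i → DegreeTwoInterior k (rung i) k
rung-degreeTwo _ _ _ (inj₁ (e-tt _ _)) = inj₂ refl
rung-degreeTwo _ l<k _ (inj₁ (e-tp _)) = ⊥-elim (ℕ.<-irrefl refl l<k)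
rung-degreeTwo _ {l = zero} _ _ (inj₂ (e-at _)) = inj₁ refl
rung-degreeTwo _ {l = zero} _ (vt _ () _) (inj₂ (e-tt _ _))
rung-degreeTwo _ {l = suc _} _ _ (inj₂ (e-tt _ _)) = inj₁ refl
rung-degreeTwo _ l<k _ (inj₂ (e-pt _ _ _)) = ⊥-elim (ℕ.<-irrefl refl l<k)

≤∸1⇒< : ∀ {m k} → 1 ≤ k → m ≤ k ∸ 1 → m < k
≤∸1⇒< {k = suc _} _ m≤k = s≤s m≤k

pathP-degreeTwo : ∀ {k} j → DegreeTwoInterior k (pathP k j) k
pathP-degreeTwo {k} j {l} {w} l<k v e =
  neighbours l<k v (subst (λ u → Adjacent k u w) (pathP-interior l<k) e)
  where
  neighbours : ∀ {l} → suc l < k → Valid k w → Adjacent k (p j (suc l)) w →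
               w ≡ pathP k j l ⊎ w ≡ pathP k j (suc (suc l))
  neighbours l<k (vp _ _ _ l≤k) (inj₁ (e-pp _ _)) =
    inj₂ (sym (pathP-interior (≤∸1⇒< (ℕ.≤-trans (s≤s z≤n) l<k) l≤k)))
  neighbours l<k _ (inj₁ (e-pt _ _ refl)) = inj₂ (sym (pathP-end (ℕ.≤-trans (s≤s z≤n) l<k)))
  neighbours {zero} _ _ (inj₂ (e-tp _)) = inj₁ refl
  neighbours {zero} _ (vp _ _ () _) (inj₂ (e-pp _ _))
  neighbours {suc l} l<k _ (inj₂ (e-pp _ _)) = inj₁ (sym (pathP-interior (ℕ.<-trans (ℕ.n<1+n _) l<k)))

pathQ-degreeTwo : ∀ {k} j → DegreeTwoInterior k (pathQ k j) (suc k)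
pathQ-degreeTwo {k} j {l} {w} (s≤s l<k) v e =
  neighbours l<k v (subst (λ u → Adjacent k u w) (pathQ-interior l<k) e)
  where
  neighbours : ∀ {l} → l < k → Valid k w → Adjacent k (q j (suc l)) w →
               w ≡ pathQ k j l ⊎ w ≡ pathQ k j (suc (suc l))
  neighbours _ (vq _ _ _ l<k) (inj₁ (e-qq _ _)) = inj₂ (sym (pathQ-interior l<k))
  neighbours _ _ (inj₁ (e-qb _)) = inj₂ (sym pathQ-end)
  neighbours {zero} _ _ (inj₂ (e-cq _)) = inj₁ refl
  neighbours {zero} _ (vq _ _ () _) (inj₂ (e-qq _ _))
  neighbours {suc l} l<k _ (inj₂ (e-qq _ _)) = inj₁ (sym (pathQ-interior (ℕ.<-trans (ℕ.n<1+n _) l<k)))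

reverse-degreeTwo : ∀ {k π N} → DegreeTwoInterior k π N → DegreeTwoInterior k (λ l → π (N ∸ l)) N
reverse-degreeTwo {k} {π} {N} interior {l} {w} l<N v e =
  swap (map₂ (λ w≡π₂₊ₘ → trans w≡π₂₊ₘ (cong π (sym N∸l≡2+m))) (interior m<N v e′))
  where
  m : ℕ
  m = N ∸ suc (suc l)
  N∸[1+l]≡1+m : N ∸ suc l ≡ suc m
  N∸[1+l]≡1+m = ℕ.+-∸-assoc 1 l<N
  N∸l≡2+m : N ∸ l ≡ suc (suc m)
  N∸l≡2+m = trans (ℕ.+-∸-assoc 1 (ℕ.<⇒≤ l<N)) (cong suc N∸[1+l]≡1+m)
  m<N : suc m < N
  m<N = subst (_< N) N∸[1+l]≡1+m (ℕ.∸-monoʳ-< (s≤s z≤n) (ℕ.<⇒≤ l<N))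
  e′ : Adjacent k (π (suc m)) w
  e′ = subst (λ i → Adjacent k (π i) w) N∸[1+l]≡1+m e

blockSize : ℕ → ℕ
blockSize k = suc (suc (k ℕ.+ k))

-- Copy F_i, together with the paths P_i and Q_i arriving at it, occupies the block
-- [i · blockSize k, (i + 1) · blockSize k); inside a block the height falls from b_i and a_i
-- down the rung and along P_i and Q_i.
height : ℕ → Vtx → ℕ
height k (a i)   = i ℕ.* blockSize k ℕ.+ (k ℕ.+ k)
height k (b i)   = i ℕ.* blockSize k ℕ.+ suc (k ℕ.+ k)
height k (c i)   = i ℕ.* blockSize k ℕ.+ k
height k (t i l) = i ℕ.* blockSize k ℕ.+ (k ℕ.+ k ∸ l)
height k (p i l) = i ℕ.* blockSize k ℕ.+ (k ∸ l)
height k (q i l) = i ℕ.* blockSize k ℕ.+ (k ∸ l)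

within-block : ∀ {B x y} i → x < y → i ℕ.* B ℕ.+ x < i ℕ.* B ℕ.+ y
within-block {B} i = ℕ.+-monoʳ-< (i ℕ.* B)

next-block : ∀ {B x} i y → x < B → i ℕ.* B ℕ.+ x < suc i ℕ.* B ℕ.+ y
next-block {B} {x} i y x<B = begin-strict
  i ℕ.* B ℕ.+ x   <⟨ ℕ.+-monoʳ-< (i ℕ.* B) x<B ⟩
  i ℕ.* B ℕ.+ B   ≡⟨ ℕ.+-comm (i ℕ.* B) B ⟩
  suc i ℕ.* B     ≤⟨ ℕ.m≤m+n (suc i ℕ.* B) y ⟩
  suc i ℕ.* B ℕ.+ y ∎
  where open ℕ.≤-Reasoning

Descending : ℕ → (ℕ → Vtx) → ℕ → Set
Descending k π N = ∀ {l} → suc l < N → height k (π (suc l)) < height k (π l)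

rung-descending : ∀ {k} i → Descending k (rung i) k
rung-descending {k} i {zero} 1<k =
  within-block i (ℕ.∸-monoʳ-< (s≤s z≤n) (ℕ.≤-trans (ℕ.<⇒≤ 1<k) (ℕ.m≤m+n k k)))
rung-descending {k} i {suc l} l<k =
  within-block i (ℕ.∸-monoʳ-< (ℕ.n<1+n _) (ℕ.≤-trans (ℕ.<⇒≤ l<k) (ℕ.m≤m+n k k)))

pathP-descending : ∀ {k} j → Descending k (pathP k j) k
pathP-descending {k} j {zero} 1<k rewrite pathP-interior {j = j} 1<k | ℕ.m+n∸n≡m k k =
  within-block j (ℕ.∸-monoʳ-< (s≤s z≤n) (ℕ.<⇒≤ 1<k))
pathP-descending {k} j {suc l} l<k
  rewrite pathP-interior {j = j} l<k | pathP-interior {j = j} (ℕ.<-trans (ℕ.n<1+n _) l<k) =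
  within-block j (ℕ.∸-monoʳ-< (ℕ.n<1+n _) (ℕ.<⇒≤ l<k))

pathQ-descending : ∀ {k} j → Descending k (pathQ k j) (suc k)
pathQ-descending {k} j {zero} (s≤s 0<k) rewrite pathQ-interior {j = j} 0<k =
  within-block j (ℕ.∸-monoʳ-< (s≤s z≤n) 0<k)
pathQ-descending {k} j {suc l} (s≤s l<k)
  rewrite pathQ-interior {j = j} l<k | pathQ-interior {j = j} (ℕ.<-trans (ℕ.n<1+n _) l<k) =
  within-block j (ℕ.∸-monoʳ-< (ℕ.n<1+n _) l<k)

Even : ℤ → Set
Even z = + 2 ∣ z

Even-2 : Even (+ 2)
Even-2 = divides 1ℤ refl

¬Even1 : ¬ Even 1ℤ
¬Even1 2∣1 with ℕ.∣⇒≤ (∣⇒∣ᵤ 2∣1)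
... | s≤s ()

odd-and-even : ∀ {z} → Even z → ¬ Even (1ℤ + z)
odd-and-even even odd = ¬Even1 (∣m+n∣n⇒∣m odd even)

-- An even hole v₀ … v₍ₙ₋₁₎ unrolled to the walk x ↦ v₍ₓ mod ₙ₎; of its length n only the
-- facts that n is even and at least 4 survive, in the last three fields.
record EvenHoleUnrolling (k : ℕ) (W : ℤ → Vtx) : Set where
  field
    valid            : ∀ x → Valid k (W x)
    adjacent-suc     : ∀ x → Adjacent k (W x) (W (x + 1ℤ))
    odd⇒distinct     : ∀ {x y} → Even (1ℤ + (y - x)) → W x ≢ W y
    even⇒nonadjacent : ∀ {x y} → Even (y - x) → ¬ Adjacent k (W x) (W y)
    two⇒distinct     : ∀ {x y} → y - x ≡ + 2 → W x ≢ W y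

reflect : ∀ {k W} → EvenHoleUnrolling k W → EvenHoleUnrolling k (λ x → W (- x))
reflect {k} {W} hole = record
  { valid            = λ x → valid (- x)
  ; adjacent-suc     = λ x →
      swap (subst (λ z → Adjacent k (W (- (x + 1ℤ))) (W z)) (neg-suc x) (adjacent-suc (- (x + 1ℤ))))
  ; odd⇒distinct     = λ {x} {y} odd →
      odd⇒distinct (subst Even (neg-odd x y) (∣m∣n⇒∣m+n (∣m⇒∣-m odd) Even-2))
  ; even⇒nonadjacent = λ {x} {y} even → even⇒nonadjacent (subst Even (neg-diff x y) (∣m⇒∣-m even))
  ; two⇒distinct     = λ {x} {y} two eq → two⇒distinct (trans (swap-diff x y) two) (sym eq)
  }
  where
  open EvenHoleUnrolling hole
  neg-suc : ∀ x → - (x + 1ℤ) + 1ℤ ≡ - x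
  neg-suc = solve-∀
  neg-diff : ∀ x y → - (y - x) ≡ (- y) - (- x)
  neg-diff = solve-∀
  neg-odd : ∀ x y → - (1ℤ + (y - x)) + + 2 ≡ 1ℤ + ((- y) - (- x))
  neg-odd = solve-∀
  swap-diff : ∀ x y → (- x) - (- y) ≡ y - x
  swap-diff = solve-∀

module Walk {k : ℕ} {W : ℤ → Vtx} (hole : EvenHoleUnrolling k W) where
  open EvenHoleUnrolling hole

  adjacent-pred : ∀ x → Adjacent k (W x) (W (x - 1ℤ))
  adjacent-pred x = swap (subst (λ z → Adjacent k (W (x - 1ℤ)) (W z)) (pred-suc x) (adjacent-suc (x - 1ℤ)))
    where
    pred-suc : ∀ x → x - 1ℤ + 1ℤ ≡ x
    pred-suc = solve-∀

  from-suc : ∀ {x v} → W x ≡ v → Adjacent k v (W (x + 1ℤ))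
  from-suc refl = adjacent-suc _

  from-pred : ∀ {x v} → W x ≡ v → Adjacent k v (W (x - 1ℤ))
  from-pred refl = adjacent-pred _

  -- Turning back inside the path would repeat a vertex two steps later.
  follow : ∀ {π N x} → DegreeTwoInterior k π N → W x ≡ π 0 → W (x + 1ℤ) ≡ π 1 →
           ∀ l → suc l ≤ N → W (x + + l) ≡ π l × W (x + + suc l) ≡ π (suc l)
  follow {x = x} _ w₀ w₁ zero _ = subst (λ z → W z ≡ _) (sym (+-identityʳ x)) w₀ , w₁
  follow {π} {x = x} interior w₀ w₁ (suc l) l<N
    with follow interior w₀ w₁ l (ℕ.<⇒≤ l<N)
  ... | wₗ , w₁₊ₗ
    with interior l<N (valid _) (from-suc w₁₊ₗ)
  ... | inj₁ back = ⊥-elim (two⇒distinct (two-steps x (+ l)) (trans wₗ (sym back)))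
    where
    two-steps : ∀ x L → (x + (1ℤ + L) + 1ℤ) - (x + L) ≡ + 2
    two-steps = solve-∀
  ... | inj₂ ahead = w₁₊ₗ , subst (λ z → W z ≡ π (suc (suc l))) (step x (+ l)) ahead
    where
    step : ∀ x L → x + (1ℤ + L) + 1ℤ ≡ x + (1ℤ + (1ℤ + L))
    step = solve-∀

  arrive : ∀ {π N x} → DegreeTwoInterior k π (suc N) → W x ≡ π 0 → W (x + 1ℤ) ≡ π 1 →
           W (x + + suc N) ≡ π (suc N) × W (x + + suc N - 1ℤ) ≡ π N
  arrive {π} {N} {x} interior w₀ w₁ =
    proj₂ walked , subst (λ z → W z ≡ π N) (sym (back x (+ N))) (proj₁ walked)
    where
    walked : W (x + + N) ≡ π N × W (x + + suc N) ≡ π (suc N)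
    walked = follow interior w₀ w₁ N ℕ.≤-refl
    back : ∀ x L → x + (1ℤ + L) - 1ℤ ≡ x + L
    back = solve-∀

  chord : ∀ {x y u v} → Even (y - x) → W x ≡ u → W y ≡ v → ¬ Adjacent k u v
  chord even refl refl = even⇒nonadjacent even

  two-apart : ∀ {x y u v} → y - x ≡ + 2 → W x ≡ u → W y ≡ v → ¬ (u ≡ v ⊎ Adjacent k u v)
  two-apart d refl refl (inj₁ same) = two⇒distinct d same
  two-apart d wₓ wᵧ (inj₂ adj) = chord (subst Even (sym d) Even-2) wₓ wᵧ adj

  around : ∀ x → (x + 1ℤ) - (x - 1ℤ) ≡ + 2
  around = solve-∀

  Peak : ℤ → Set
  Peak m = ∀ x → height k (W x) ≤ height k (W m)

  above-peak : ∀ {m x u v} → Peak m → W m ≡ u → W x ≡ v → height k u < height k v → ⊥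
  above-peak {x = x} peak refl refl u<v = ℕ.<⇒≱ u<v (peak x)

  not-peak-inside : ∀ {π N l m} → DegreeTwoInterior k π N → Descending k π N → suc l < N →
                    W m ≡ π (suc l) → ¬ Peak m
  not-peak-inside {π} {l = l} {m} interior descending l<N wₘ peak
    with interior l<N (valid _) (from-suc wₘ) | interior l<N (valid _) (from-pred wₘ)
  ... | inj₁ higher | _ = above-peak peak wₘ higher (descending l<N)
  ... | _ | inj₁ higher = above-peak peak wₘ higher (descending l<N)
  ... | inj₂ next | inj₂ prev = two-apart (around m) prev next (inj₁ refl)

arrive-backward : ∀ {k W} → EvenHoleUnrolling k W → ∀ {π N x} → DegreeTwoInterior k π (suc N) →
                  W x ≡ π 0 → W (x - 1ℤ) ≡ π 1 →
                  W (x - + suc N) ≡ π (suc N) × W (x - + suc N + 1ℤ) ≡ π N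
arrive-backward {W = W} hole {π} {N} {x} interior w₀ w₁ =
  subst (λ z → W z ≡ π (suc N)) (far x (+ suc N)) (proj₁ reflected) ,
  subst (λ z → W z ≡ π N) (near x (+ suc N)) (proj₂ reflected)
  where
  neg-neg : ∀ x → - (- x) ≡ x
  neg-neg = solve-∀
  neg-pred : ∀ x → - (- x + 1ℤ) ≡ x - 1ℤ
  neg-pred = solve-∀
  far : ∀ x L → - (- x + L) ≡ x - L
  far = solve-∀
  near : ∀ x L → - (- x + L - 1ℤ) ≡ x - L + 1ℤ
  near = solve-∀
  reflected : W (- (- x + + suc N)) ≡ π (suc N) × W (- (- x + + suc N - 1ℤ)) ≡ π N
  reflected = Walk.arrive (reflect hole) {x = - x} interior
                (subst (λ z → W z ≡ π 0) (sym (neg-neg x)) w₀)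
                (subst (λ z → W z ≡ π 1) (sym (neg-pred x)) w₁)

module Descent (k₂ : ℕ) {W : ℤ → Vtx} (hole : EvenHoleUnrolling (suc (suc k₂)) W) where
  open EvenHoleUnrolling hole
  open Walk hole

  k : ℕ
  k = suc (suc k₂)

  2≤k : 2 ≤ k
  2≤k = s≤s (s≤s z≤n)

  two-back : ∀ x → x - (x - 1ℤ - 1ℤ) ≡ + 2
  two-back = solve-∀

  triangle-exit : ∀ {x j} → W x ≡ a j ⊎ W x ≡ b j → W (x - 1ℤ) ≡ c j → W (x - 1ℤ - 1ℤ) ≡ q j 1
  triangle-exit {x} {j} wₓ w₋₁ with neighbours-c (from-pred w₋₁) | wₓ
  ... | inj₂ (inj₂ exit) | _      = exit
  ... | inj₁ back | inj₁ wₓ≡a     = ⊥-elim (two-apart (two-back x) back wₓ≡a (inj₁ refl))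
  ... | inj₁ back | inj₂ wₓ≡b     = ⊥-elim (two-apart (two-back x) back wₓ≡b (inj₂ (inj₁ (e-ab j))))
  ... | inj₂ (inj₁ back) | inj₁ wₓ≡a =
    ⊥-elim (two-apart (two-back x) back wₓ≡a (inj₂ (inj₂ (e-ab j))))
  ... | inj₂ (inj₁ back) | inj₂ wₓ≡b = ⊥-elim (two-apart (two-back x) back wₓ≡b (inj₁ refl))

  -- The invariant Even (u - l + k) below records the parity of the distance between the two
  -- ends of the hole as they descend through the copies, r_j at position u and b_j at l.
  leave-b : ∀ {j u l} → Even (u - l + + k) → W u ≡ t j k → W l ≡ b j → W (l + 1ℤ) ≡ q (suc j) k →
            W (l - 1ℤ) ≡ c j
  leave-b {j} {u} {l} even wᵤ wₗ wₗ₊₁ with neighbours-b (from-pred wₗ)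
  ... | inj₂ (inj₁ to-c) = to-c
  ... | inj₂ (inj₂ to-q) = ⊥-elim (two-apart (around l) to-q wₗ₊₁ (inj₁ refl))
  ... | inj₁ to-a with neighbours-a (from-pred to-a)
  ...   | inj₁ to-b        = ⊥-elim (two-apart (two-back l) to-b wₗ (inj₁ refl))
  ...   | inj₂ (inj₁ to-c) = ⊥-elim (two-apart (two-back l) to-c wₗ (inj₂ (inj₂ (e-bc j))))
  ...   | inj₂ (inj₂ to-t) =
    ⊥-elim (odd⇒distinct odd (trans (proj₁ (arrive-backward hole (rung-degreeTwo j) to-a to-t)) (sym wᵤ)))
    where
    shift : ∀ u l K → (u - l + K) + + 2 ≡ 1ℤ + (u - (l - 1ℤ - K))
    shift = solve-∀
    odd : Even (1ℤ + (u - (l - 1ℤ - + k)))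
    odd = subst Even (shift u l (+ k)) (∣m∣n⇒∣m+n even Even-2)

  leave-r : ∀ {j u l} → Even (u - l + + k) → W u ≡ t j k → W (u - 1ℤ) ≡ p (suc j) (pred k) →
            W l ≡ b j → W (u + 1ℤ) ≡ p j 1
  leave-r {j} {u} {l} even wᵤ wᵤ₋₁ wₗ with neighbours-r 2≤k (valid _) (from-suc wᵤ)
  ... | inj₂ (inj₁ to-p) = to-p
  ... | inj₂ (inj₂ back) = ⊥-elim (two-apart (around u) wᵤ₋₁ back (inj₁ refl))
  ... | inj₁ down = ⊥-elim (chord (subst Even (flip u l (+ k)) (∣m⇒∣-m even)) at-a wₗ (inj₁ (e-ab j)))
    where
    flip : ∀ u l K → - (u - l + K) ≡ l - (u + K)
    flip = solve-∀
    at-a : W (u + + k) ≡ a j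
    at-a = trans (proj₁ (arrive {π = λ l → rung j (k ∸ l)} (reverse-degreeTwo (rung-degreeTwo j)) wᵤ down))
                 (cong (rung j) (ℕ.n∸n≡0 k₂))

  mutual
    descend : ∀ j {u l} → Even (u - l + + k) → W u ≡ t j k → W (u - 1ℤ) ≡ p (suc j) (pred k) →
              W l ≡ b j → W (l + 1ℤ) ≡ q (suc j) k → ⊥
    descend zero even wᵤ wᵤ₋₁ wₗ wₗ₊₁
      with subst (Valid k) (triangle-exit (inj₂ wₗ) (leave-b even wᵤ wₗ wₗ₊₁)) (valid _)
    ... | vq () _ _ _
    descend (suc j) {l = l} even wᵤ wᵤ₋₁ wₗ wₗ₊₁ =
      cross j even wᵤ (leave-r even wᵤ wᵤ₋₁ wₗ) to-c (triangle-exit (inj₂ wₗ) to-c)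
      where
      to-c : W (l - 1ℤ) ≡ c (suc j)
      to-c = leave-b even wᵤ wₗ wₗ₊₁

    cross : ∀ j {u l} → Even (u - l + + k) → W u ≡ t (suc j) k → W (u + 1ℤ) ≡ p (suc j) 1 →
            W (l - 1ℤ) ≡ c (suc j) → W (l - 1ℤ - 1ℤ) ≡ q (suc j) 1 → ⊥
    cross j {u} {l} even wᵤ wᵤ₊₁ w₋₁ w₋₂ =
      descend j (subst Even (shift u l (+ k)) (∣m∣n⇒∣m+n even (divides (1ℤ + + k) refl)))
        (trans (proj₁ along-P) (pathP-end (s≤s z≤n)))
        (trans (proj₂ along-P) (pathP-interior ℕ.≤-refl))
        (trans (proj₁ along-Q) pathQ-end)
        (trans (proj₂ along-Q) (pathQ-interior ℕ.≤-refl))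
      where
      shift : ∀ u l K → (u - l + K) + (1ℤ + K) * + 2 ≡ (u + K) - (l - 1ℤ - (1ℤ + K)) + K
      shift = solve-∀
      along-P : W (u + + k) ≡ pathP k (suc j) k × W (u + + k - 1ℤ) ≡ pathP k (suc j) (pred k)
      along-P = arrive (pathP-degreeTwo (suc j)) wᵤ wᵤ₊₁
      along-Q : W (l - 1ℤ - + suc k) ≡ pathQ k (suc j) (suc k) × W (l - 1ℤ - + suc k + 1ℤ) ≡ pathQ k (suc j) k
      along-Q = arrive-backward hole (pathQ-degreeTwo (suc j)) w₋₁ w₋₂

  leave-apex : ∀ {i m} → Peak m → W m ≡ a i → W (m + 1ℤ) ≡ t i 1 →
               W (m + + k) ≡ t i k × W (m + + k + 1ℤ) ≡ p i 1
  leave-apex {i} {m} peak wₘ wₘ₊₁ = leave (arrive (rung-degreeTwo i) wₘ wₘ₊₁)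
    where
    leave : W (m + + k) ≡ t i k × W (m + + k - 1ℤ) ≡ t i (pred k) →
            W (m + + k) ≡ t i k × W (m + + k + 1ℤ) ≡ p i 1
    leave (at-r , before-r) with neighbours-r 2≤k (valid _) (from-suc at-r)
    ... | inj₁ back        = ⊥-elim (two-apart (around (m + + k)) before-r back (inj₁ refl))
    ... | inj₂ (inj₂ high) = ⊥-elim (above-peak peak wₘ high (next-block i _ (s≤s (ℕ.n≤1+n _))))
    ... | inj₂ (inj₁ to-p) = at-r , to-p

  from-peak : ∀ i {m} → Peak m → W m ≡ a i → W (m + 1ℤ) ≡ t i 1 → W (m - 1ℤ) ≡ c i → ⊥
  from-peak zero peak wₘ wₘ₊₁ _ with subst (Valid k) (proj₂ (leave-apex peak wₘ wₘ₊₁)) (valid _)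
  ... | vp () _ _ _
  from-peak (suc i) {m} peak wₘ wₘ₊₁ wₘ₋₁ with leave-apex peak wₘ wₘ₊₁
  ... | at-r , to-p =
    cross i (subst Even (double m (+ k)) (divides (+ k) refl)) at-r to-p wₘ₋₁ (triangle-exit (inj₁ wₘ) wₘ₋₁)
    where
    double : ∀ m K → K * + 2 ≡ (m + K) - m + K
    double = solve-∀

module Peaks (k₂ : ℕ) {W : ℤ → Vtx} (hole : EvenHoleUnrolling (suc (suc k₂)) W) where
  open EvenHoleUnrolling hole
  open Walk hole

  k : ℕ
  k = suc (suc k₂)

  2≤k : 2 ≤ k
  2≤k = s≤s (s≤s z≤n)

  apex-not-peak : ∀ {i m} → W m ≡ a i → ¬ Peak m
  apex-not-peak {i} {m} wₘ peak with neighbours-a (from-suc wₘ) | neighbours-a (from-pred wₘ)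
  ... | inj₁ high | _ = above-peak peak wₘ high (within-block i (ℕ.n<1+n _))
  ... | _ | inj₁ high = above-peak peak wₘ high (within-block i (ℕ.n<1+n _))
  ... | inj₂ (inj₁ next) | inj₂ (inj₁ prev) = two-apart (around m) prev next (inj₁ refl)
  ... | inj₂ (inj₂ next) | inj₂ (inj₂ prev) = two-apart (around m) prev next (inj₁ refl)
  ... | inj₂ (inj₂ next) | inj₂ (inj₁ prev) = Descent.from-peak k₂ hole i peak wₘ next prev
  ... | inj₂ (inj₁ next) | inj₂ (inj₂ prev) =
    Descent.from-peak k₂ (reflect hole) i reflected-peak
      (trans (cong W (neg-neg m)) wₘ) (trans (cong W (neg-pred m)) prev) (trans (cong W (neg-suc m)) next)
    where
    neg-neg : ∀ x → - (- x) ≡ x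
    neg-neg = solve-∀
    neg-pred : ∀ m → - (- m + 1ℤ) ≡ m - 1ℤ
    neg-pred = solve-∀
    neg-suc : ∀ m → - (- m - 1ℤ) ≡ m + 1ℤ
    neg-suc = solve-∀
    reflected-peak : Walk.Peak (reflect hole) (- m)
    reflected-peak x = subst (λ z → height k (W (- x)) ≤ height k (W z)) (sym (neg-neg m)) (peak (- x))

  b-not-peak : ∀ {i m} → W m ≡ b i → ¬ Peak m
  b-not-peak {i} {m} wₘ peak with neighbours-b (from-suc wₘ) | neighbours-b (from-pred wₘ)
  ... | inj₂ (inj₂ high) | _ = above-peak peak wₘ high (next-block i _ ℕ.≤-refl)
  ... | _ | inj₂ (inj₂ high) = above-peak peak wₘ high (next-block i _ ℕ.≤-refl)
  ... | inj₁ next | inj₁ prev = two-apart (around m) prev next (inj₁ refl)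
  ... | inj₂ (inj₁ next) | inj₂ (inj₁ prev) = two-apart (around m) prev next (inj₁ refl)
  ... | inj₁ next | inj₂ (inj₁ prev) = two-apart (around m) prev next (inj₂ (inj₁ (e-ca i)))
  ... | inj₂ (inj₁ next) | inj₁ prev = two-apart (around m) prev next (inj₂ (inj₂ (e-ca i)))

  c<a : k < k ℕ.+ k
  c<a = ℕ.m<m+n k (s≤s z≤n)

  c<b : k < suc (k ℕ.+ k)
  c<b = ℕ.<-trans c<a (ℕ.n<1+n _)

  c-not-peak : ∀ {i m} → W m ≡ c i → ¬ Peak m
  c-not-peak {i} {m} wₘ peak with neighbours-c (from-suc wₘ) | neighbours-c (from-pred wₘ)
  ... | inj₁ high | _ = above-peak peak wₘ high (within-block i c<a)
  ... | inj₂ (inj₁ high) | _ = above-peak peak wₘ high (within-block i c<b)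
  ... | _ | inj₁ high = above-peak peak wₘ high (within-block i c<a)
  ... | _ | inj₂ (inj₁ high) = above-peak peak wₘ high (within-block i c<b)
  ... | inj₂ (inj₂ next) | inj₂ (inj₂ prev) = two-apart (around m) prev next (inj₁ refl)

  r<t : k ℕ.+ k ∸ k < k ℕ.+ k ∸ pred k
  r<t = ℕ.∸-monoʳ-< (ℕ.n<1+n _) (ℕ.m≤m+n k k)

  r<B : k ℕ.+ k ∸ k < blockSize k
  r<B = s≤s (ℕ.≤-trans (ℕ.m∸n≤m (k ℕ.+ k) k) (ℕ.n≤1+n _))

  r-not-peak : ∀ {i m} → W m ≡ t i k → ¬ Peak m
  r-not-peak {i} {m} wₘ peak
    with neighbours-r 2≤k (valid _) (from-suc wₘ) | neighbours-r 2≤k (valid _) (from-pred wₘ)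
  ... | inj₁ high | _ = above-peak peak wₘ high (within-block i r<t)
  ... | _ | inj₁ high = above-peak peak wₘ high (within-block i r<t)
  ... | inj₂ (inj₂ high) | _ = above-peak peak wₘ high (next-block i _ r<B)
  ... | _ | inj₂ (inj₂ high) = above-peak peak wₘ high (next-block i _ r<B)
  ... | inj₂ (inj₁ next) | inj₂ (inj₁ prev) = two-apart (around m) prev next (inj₁ refl)

  no-peak : ∀ m → ¬ Peak m
  no-peak m = classify (W m) refl (valid m)
    where
    classify : ∀ v → W m ≡ v → Valid k v → ¬ Peak m
    classify (a _) wₘ _ = apex-not-peak wₘ
    classify (b _) wₘ _ = b-not-peak wₘ
    classify (c _) wₘ _ = c-not-peak wₘ
    classify (t i (suc l)) wₘ (vt _ _ l<k) with ℕ.m≤n⇒m<n∨m≡n l<k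
    ... | inj₁ l<k′ = not-peak-inside (rung-degreeTwo i) (rung-descending i) l<k′ wₘ
    ... | inj₂ refl = r-not-peak wₘ
    classify (p j (suc l)) wₘ (vp _ _ _ l≤k) =
      not-peak-inside (pathP-degreeTwo j) (pathP-descending j) l<k (trans wₘ (sym (pathP-interior l<k)))
      where
      l<k : suc l < k
      l<k = ≤∸1⇒< (s≤s z≤n) l≤k
    classify (q j (suc l)) wₘ (vq _ _ _ l<k) =
      not-peak-inside (pathQ-degreeTwo j) (pathQ-descending j) (s≤s l<k) (trans wₘ (sym (pathQ-interior l<k)))

cyclic-gap-odd : ∀ {n} → Even (+ n) → ∀ {i j : Fin n} → CycAdj n i j →
                 Even (1ℤ + (+ toℕ j - + toℕ i))
cyclic-gap-odd _ {i} (inj₁ i+1≡j) rewrite sym i+1≡j = subst Even (two (+ toℕ i)) Even-2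
  where
  two : ∀ I → + 2 ≡ 1ℤ + ((1ℤ + I) - I)
  two = solve-∀
cyclic-gap-odd _ {j = j} (inj₂ (inj₁ j+1≡i)) rewrite sym j+1≡i = divides 0ℤ (back (+ toℕ j))
  where
  back : ∀ J → 1ℤ + (J - (1ℤ + J)) ≡ 0ℤ * + 2
  back = solve-∀
cyclic-gap-odd n-even {i} {j} (inj₂ (inj₂ (inj₁ (i≡0 , j+1≡n)))) rewrite i≡0 =
  subst Even (wrap (+ toℕ j)) (subst (λ m → Even (+ m)) (sym j+1≡n) n-even)
  where
  wrap : ∀ J → 1ℤ + J ≡ 1ℤ + (J - 0ℤ)
  wrap = solve-∀
cyclic-gap-odd n-even {i} {j} (inj₂ (inj₂ (inj₂ (j≡0 , i+1≡n)))) rewrite j≡0 =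
  subst Even (wrap (+ toℕ i)) (∣m∣n⇒∣m-n Even-2 (subst (λ m → Even (+ m)) (sym i+1≡n) n-even))
  where
  wrap : ∀ I → + 2 - (1ℤ + I) ≡ 1ℤ + (0ℤ - I)
  wrap = solve-∀

∣∧<⇒≡0 : ∀ {n d} → n ℕ.∣ d → d < n → d ≡ 0
∣∧<⇒≡0 {d = zero}  _   _   = refl
∣∧<⇒≡0 {d = suc _} n∣d d<n = ⊥-elim (ℕ.>⇒∤ d<n n∣d)

congruent⇒∸≡0 : ∀ {n i j} → + n ∣ + i - + j → j ≤ i → i < n → i ∸ j ≡ 0
congruent⇒∸≡0 {n} {i} {j} n∣i-j j≤i i<n =
  ∣∧<⇒≡0 (subst (n ℕ.∣_) (cong ∣_∣ (trans (m-n≡m⊖n i j) (⊖-≥ j≤i))) (∣⇒∣ᵤ n∣i-j))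
                 (ℕ.≤-<-trans (ℕ.m∸n≤m i j) i<n)

congruent-below⇒equal : ∀ {n i j} → + n ∣ + i - + j → i < n → j < n → i ≡ j
congruent-below⇒equal {n} {i} {j} n∣i-j i<n j<n with ℕ.≤-total j i
... | inj₁ j≤i = sym (ℕ.≤-antisym j≤i (ℕ.m∸n≡0⇒m≤n (congruent⇒∸≡0 n∣i-j j≤i i<n)))
... | inj₂ i≤j = ℕ.≤-antisym i≤j (ℕ.m∸n≡0⇒m≤n (congruent⇒∸≡0 n∣j-i i≤j j<n))
  where
  flip : ∀ I J → - (I - J) ≡ J - I
  flip = solve-∀
  n∣j-i : + n ∣ + j - + i
  n∣j-i = subst (+ n ∣_) (flip (+ i) (+ j)) (∣m⇒∣-m n∣i-j)

successor-residue : ∀ {n r s} → r < n → s < n → + n ∣ + suc r - + s →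
                    suc r ≡ s ⊎ (s ≡ 0 × suc r ≡ n)
successor-residue {n} {r} {s} r<n s<n n∣gap with ℕ.m≤n⇒m<n∨m≡n r<n
... | inj₁ r+1<n = inj₁ (congruent-below⇒equal n∣gap r+1<n s<n)
... | inj₂ refl  = inj₂ (sym (congruent-below⇒equal n∣-s (s≤s z≤n) s<n) , refl)
  where
  wrap : ∀ N S → (N - S) - N ≡ + 0 - S
  wrap = solve-∀
  n∣-s : + n ∣ + 0 - + s
  n∣-s = subst (+ n ∣_) (wrap (+ n) (+ s)) (∣m∣n⇒∣m-n n∣gap ∣-refl)

module Unrolling {k n : ℕ} .{{_ : ℕ.NonZero n}} (n-even : Even (+ n)) (4≤n : 4 ≤ n)
  (f : Fin n → Σ Vtx (Valid k)) (f-injective : Injective _≡_ _≡_ f)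
  (f-cycle : ∀ i j → Graph.Adj (G k) (f i) (f j) ⇔ CycAdj n i j) where

  position : ℤ → Fin n
  position x = fromℕ< (n%ℕd<d x n)

  W : ℤ → Vtx
  W x = proj₁ (f (position x))

  residue : ℤ → ℤ
  residue x = + toℕ (position x)

  congruent : ∀ x y → + n ∣ (y - x) - (residue y - residue x)
  congruent x y rewrite toℕ-fromℕ< (n%ℕd<d x n) | toℕ-fromℕ< (n%ℕd<d y n) =
    divides (y /ℕ n - x /ℕ n) (begin
      (y - x) - (+ (y %ℕ n) - + (x %ℕ n))
        ≡⟨ cong₂ (λ y′ x′ → (y′ - x′) - (+ (y %ℕ n) - + (x %ℕ n)))
                 (a≡a%ℕn+[a/ℕn]*n y n) (a≡a%ℕn+[a/ℕn]*n x n) ⟩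
      ((+ (y %ℕ n) + y /ℕ n * + n) - (+ (x %ℕ n) + x /ℕ n * + n)) - (+ (y %ℕ n) - + (x %ℕ n))
        ≡⟨ cancel (+ (y %ℕ n)) (+ (x %ℕ n)) (y /ℕ n) (x /ℕ n) (+ n) ⟩
      (y /ℕ n - x /ℕ n) * + n ∎)
    where
    open ≡-Reasoning
    cancel : ∀ R S Q P N → ((R + Q * N) - (S + P * N)) - (R - S) ≡ (Q - P) * N
    cancel = solve-∀

  same-position : ∀ {x y} → position x ≡ position y → + n ∣ y - x
  same-position {x} {y} eq = subst (+ n ∣_) (drop (y - x) (residue x)) gap
    where
    gap : + n ∣ (y - x) - (residue x - residue x)
    gap = subst (λ r → + n ∣ (y - x) - (r - residue x)) (cong (λ i → + toℕ i) (sym eq)) (congruent x y)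
    drop : ∀ z R → z - (R - R) ≡ z
    drop = solve-∀

  adjacent-positions : ∀ x → CycAdj n (position x) (position (x + 1ℤ))
  adjacent-positions x with successor-residue (toℕ<n (position x)) (toℕ<n (position (x + 1ℤ))) n∣gap
    where
    step : ∀ x R S → (x + 1ℤ - x) - (S - R) ≡ (1ℤ + R) - S
    step = solve-∀
    n∣gap : + n ∣ + suc (toℕ (position x)) - residue (x + 1ℤ)
    n∣gap = subst (+ n ∣_) (step x (residue x) (residue (x + 1ℤ))) (congruent x (x + 1ℤ))
  ... | inj₁ next        = inj₁ next
  ... | inj₂ wrap = inj₂ (inj₂ (inj₂ wrap))

  position-injective : ∀ {x y} → W x ≡ W y → position x ≡ position y
  position-injective {x} {y} same = f-injective (Σ-≡ (f (position x)) (f (position y)) same)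
    where
    Σ-≡ : (u v : Σ Vtx (Valid k)) → proj₁ u ≡ proj₁ v → u ≡ v
    Σ-≡ (w , valid-u) (.w , valid-v) refl = cong (w ,_) (Valid-irrelevant valid-u valid-v)

  adjacent⇒odd : ∀ {x y} → Adjacent k (W x) (W y) → Even (1ℤ + (y - x))
  adjacent⇒odd {x} {y} adj =
    subst Even (regroup (y - x) (residue x) (residue y))
      (∣m∣n⇒∣m+n (∣-trans n-even (congruent x y))
                  (cyclic-gap-odd n-even (Equivalence.to (f-cycle _ _) adj)))
    where
    regroup : ∀ z R S → (z - (S - R)) + (1ℤ + (S - R)) ≡ 1ℤ + z
    regroup = solve-∀

  unrolling : EvenHoleUnrolling k W
  unrolling = record
    { valid            = λ x → proj₂ (f (position x))
    ; adjacent-suc     = λ x → Equivalence.from (f-cycle _ _) (adjacent-positions x)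
    ; odd⇒distinct     = λ {x} {y} odd same →
        odd-and-even (∣-trans n-even (same-position {x} {y} (position-injective {x} {y} same))) odd
    ; even⇒nonadjacent = λ {x} {y} even adj → odd-and-even even (adjacent⇒odd {x} {y} adj)
    ; two⇒distinct     = λ {x} {y} two same →
        too-short (subst (+ n ∣_) two (same-position {x} {y} (position-injective {x} {y} same)))
    }
    where
    too-short : ¬ (+ n ∣ + 2)
    too-short n∣2 = ℕ.<⇒≱ (ℕ.≤-trans (s≤s (s≤s (s≤s z≤n))) 4≤n) (ℕ.∣⇒≤ (∣⇒∣ᵤ n∣2))

  peak : Σ ℤ (Walk.Peak unrolling)
  peak = + toℕ top , λ x →
    subst (λ i → height k (W x) ≤ height k (proj₁ (f i))) (sym at-top)
          (lookup (f[xs]≤f[argmax] {f = vertex-height} (position 0ℤ) (allFin n)) (∈-allFin (position x)))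
    where
    vertex-height : Fin n → ℕ
    vertex-height i = height k (proj₁ (f i))
    top : Fin n
    top = argmax vertex-height (position 0ℤ) (allFin n)
    at-top : position (+ toℕ top) ≡ top
    at-top = toℕ-injective (trans (toℕ-fromℕ< _) (m<n⇒m%n≡m (toℕ<n top)))

lemma3p3 : (k : ℕ) → 4 ≤ k → ¬ HasEvenHole (G k)
lemma3p3 1 (s≤s ())
lemma3p3 (suc (suc k₂)) _ (n , 4≤n , 2∣n , f , f-injective , f-cycle) =
  Peaks.no-peak k₂ unrolling (proj₁ peak) (proj₂ peak)
  where
  instance
    n≢0 : ℕ.NonZero n
    n≢0 = ℕ.>-nonZero (ℕ.≤-trans (s≤s z≤n) 4≤n)
  open Unrolling (∣ᵤ⇒∣ 2∣n) 4≤n f f-injective f-cycle
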